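{- Let $R$ be a commutative ring, $n\ge1$, $m\ge2$, and $a\in\mathbb{N}^m$. Then: (1) the kernel of $\tilde\pi_{n,a}:A_R(\infty,m,a)\to A_R(n,m,a)^{S_n}$ is the $R$-linear span of $\{e_\alpha\in A_R(\infty,m,a): |\alpha|>n\}$; (2) $\tilde\pi_{n,a}$ is surjective for every $n$, and is an isomorphism $A_R(\infty,m,a)\cong A_R(n,m,a)^{S_n}$ whenever $n\ge a_1+\dots+a_m$; (3) $A_R(\infty,m,a)$ is a free $R$-module with basis $\{e_\alpha:\partial(e_\alpha)=a\}$; (4) $A_R(\infty,m)$ is a free $R$-module with basis $\{e_\alpha:\alpha\in\mathbb{N}^{(\mathcal M_m^+)}\}$.
   Context: $A_R(n,m)=R[x_i(j):1\le i\le m,1\le j\le n]$ with $S_n$ acting by $\sigma(x_i(j))=x_i(\sigma(j))$; $A_R(m)=R[y_1,\dots,y_m]$; $f(j):=f(x_1(j),\dots,x_m(j))$ for $f\in A_R(m)$. Multidegree in $\mathbb{N}^m$: $x_i(j)$ has the multidegree of $y_i$ (the $i$-th unit vector); $A_R(n,m,a)$ is the span of monomials of multidegree $a$. $\pi_n:A_R(n,m)\to A_R(n-1,m)$ is the $R$-algebra map with $x_i(n)\mapsto0$, $x_i(j)\mapsto x_i(j)$ for $j<n$; it maps $A_R(n,m,a)^{S_n}$ onto $A_R(n-1,m,a)^{S_{n-1}}$. $A_R(\infty,m,a):=\varprojlim_nA_R(n,m,a)^{S_n}$ along the $\pi_n$, $\tilde\pi_{n,a}$ the natural projection to the $n$-th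 term, and $A_R(\infty,m)=\bigoplus_{a\in\mathbb{N}^m}A_R(\infty,m,a)$. $\mathcal M_m^+$ is the set of monomials in $y_1,\dots,y_m$ of positive degree, $\mathbb{N}^{(\mathcal M_m^+)}$ the finitely supported $\alpha:\mathcal M_m^+\to\mathbb{N}$, $|\alpha|=\sum_\mu\alpha(\mu)$. For $n\ge|\alpha|$, $e_\alpha(n)$ is the coefficient of $\prod_\mu t_\mu^{\alpha(\mu)}$ in $\prod_{i=1}^n(1+\sum_{\mu\in\mathcal M_m^+}t_\mu\mu(i))$, and $e_\alpha(n)=0$ if $n<|\alpha|$; since $\pi_n(e_\alpha(n))=e_\alpha(n-1)$, these define $e_\alpha\in A_R(\infty,m,\partial(e_\alpha))$, where $\partial(e_\alpha)=\sum_\mu\alpha(\mu)\partial(\mu)$ ($\partial(\mu)$ the exponent vector of $\mu$); $e_0=1$. -}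

module Defs where

open import Level using (Level; _⊔_)
open import Algebra.Bundles using (CommutativeRing)
open import Data.Nat using (ℕ; zero; suc; _+_; _<_; _≤_)
import Data.Nat.Properties as ℕP
open import Data.Bool using (Bool; true; false; if_then_else_)
open import Data.Maybe using (Maybe; just; nothing)
open import Data.Product using (Σ; ∃; _×_; _,_; proj₁; proj₂)
open import Data.Fin using (Fin)
open import Data.Fin.Permutation using (Permutation′; _⟨$⟩ʳ_)
open import Data.List as List using (List; []; _∷_; length)
open import Data.List.Relation.Unary.All using (All)
open import Data.List.Relation.Unary.AllPairs using (AllPairs)
open import Data.List.Relation.Binary.Permutation.Propositional using (_↭_)
open import Data.List.Membership.Propositional using (_∈_)
open import Data.Vec as Vec using (Vec; []; _∷_; _∷ʳ_; lookup; tabulate; replicate; zipWith)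
import Data.Vec.Properties as VecP
open import Relation.Nullary using (¬_; does)
open import Relation.Binary.PropositionalEquality using (_≡_)
open import Relation.Binary.Definitions using (DecidableEquality)

-- An exponent matrix for a monomial of A_R(n,m): row i (i < m), column
-- j (j < n) is the exponent of x_i(j).
Expo : ℕ → ℕ → Set
Expo n m = Vec (Vec ℕ n) m

mdeg : ∀ {n m} → Expo n m → Vec ℕ m
mdeg E = Vec.map Vec.sum E

permExpo : ∀ {n m} → Permutation′ n → Expo n m → Expo n m
permExpo σ E = Vec.map (λ row → tabulate (λ j → lookup row (σ ⟨$⟩ʳ j))) E

-- effect of π_n on exponents: a monomial of A(n,m) viewed in A(n+1,m)
-- (no x_i(n+1) occurring), i.e. append a zero column.
extendExpo : ∀ {n m} → Expo n m → Expo (suc n) m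
extendExpo E = Vec.map (λ row → row ∷ʳ 0) E

-- j-th column of E, i.e. the exponent vector of the factor in the j-th
-- copy of the variables
column : ∀ {n m} → Expo n m → Fin n → Vec ℕ m
column E j = Vec.map (λ row → lookup row j) E

_≟v_ : ∀ {m} → DecidableEquality (Vec ℕ m)
_≟v_ = VecP.≡-dec ℕP._≟_

isZeroVec : ∀ {m} → Vec ℕ m → Bool
isZeroVec {m} v = does (v ≟v replicate m 0)

nonzeroColumns : ∀ {n m} → Expo n m → List (Vec ℕ m)
nonzeroColumns {n} E =
  List.foldr (λ j acc → if isZeroVec (column E j) then acc else column E j ∷ acc)
             [] (List.allFin n)

removeOne : ∀ {m} → Vec ℕ m → List (Vec ℕ m) → Maybe (List (Vec ℕ m))
removeOne v []       = nothing
removeOne v (w ∷ ws) with does (v ≟v w)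
... | true  = just ws
... | false = Data.Maybe.map (w ∷_) (removeOne v ws)
  where import Data.Maybe

bagEq : ∀ {m} → List (Vec ℕ m) → List (Vec ℕ m) → Bool
bagEq []       []       = true
bagEq []       (_ ∷ _)  = false
bagEq (x ∷ xs) ys with removeOne x ys
... | nothing  = false
... | just ys' = bagEq xs ys'

-- α ∈ ℕ^(M_m^+) : a finite multiset of monomials of positive degree in
-- y_1..y_m, each monomial given by its exponent vector (nonzero).
-- Two such lists represent the same α iff they are permutations of each
-- other.

Alpha : ℕ → Set
Alpha m = Σ (List (Vec ℕ m)) (All (λ v → ¬ (v ≡ replicate m 0)))

monos : ∀ {m} → Alpha m → List (Vec ℕ m)
monos = proj₁

size : ∀ {m} → Alpha m → ℕ
size α = length (monos α)

∂ : ∀ {m} → Alpha m → Vec ℕ m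
∂ {m} α = List.foldr (zipWith _+_) (replicate m 0) (monos α)

_≈α_ : ∀ {m} → Alpha m → Alpha m → Set
α ≈α β = monos α ↭ monos β

module WithRing {c ℓ : Level} (R : CommutativeRing c ℓ) where
  open CommutativeRing R renaming (Carrier to Rc; _+_ to _+R_; _*_ to _*R_)

  -- a (coefficient-function) element of A_R(n,m): E ↦ coefficient of x^E
  Poly : ℕ → ℕ → Set c
  Poly n m = Expo n m → Rc

  Homog : ∀ {n m} → Vec ℕ m → Poly n m → Set ℓ
  Homog a f = ∀ E → ¬ (mdeg E ≡ a) → f E ≈ 0#

  Sym : ∀ {n m} → Poly n m → Set ℓ
  Sym {n} f = ∀ (σ : Permutation′ n) E → f (permExpo σ E) ≈ f E

  InvHom : ∀ {n m} → Vec ℕ m → Poly n m → Set ℓ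
  InvHom a f = Homog a f × Sym f

  π : ∀ {n m} → Poly (suc n) m → Poly n m
  π f E = f (extendExpo E)

  Seq : ℕ → Set c
  Seq m = (n : ℕ) → Poly n m

  -- (f_n) ∈ A_R(∞,m,a) = lim_n A_R(n,m,a)^{S_n} along the π_n
  InLim : ∀ {m} → Vec ℕ m → Seq m → Set ℓ
  InLim a F = (∀ n → InvHom a (F n)) × (∀ n E → π (F (suc n)) E ≈ F n E)

  _≈∞_ : ∀ {m} → Seq m → Seq m → Set ℓ
  F ≈∞ G = ∀ n E → F n E ≈ G n E

  -- coefficient of x^E in e_α(n): coefficient of t^α x^E in
  -- ∏_j (1 + Σ_μ t_μ μ(j)); it is 1 iff the multiset of nonzero columns
  -- of E equals α, else 0. (Automatically 0 if n < |α|.)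
  eCoeff : ∀ {m} → Alpha m → Seq m
  eCoeff α n E = if bagEq (nonzeroColumns E) (monos α) then 1# else 0#

  combo : ∀ {m} → List (Rc × Alpha m) → Seq m
  combo L n E = List.foldr (λ p acc → (proj₁ p *R eCoeff (proj₂ p) n E) +R acc) 0# L

  -- the same combination in A_R(∞,m) = ⊕_a A_R(∞,m,a): its component of
  -- multidegree a (e_α lives in degree ∂(e_α))
  comboAt : ∀ {m} → List (Rc × Alpha m) → Vec ℕ m → Seq m
  comboAt L a n E =
    List.foldr (λ p acc → (if does (∂ (proj₂ p) ≟v a)
                            then proj₁ p *R eCoeff (proj₂ p) n E else 0#) +R acc) 0# L

  Distinct : ∀ {m} → List (Rc × Alpha m) → Set c
  Distinct L = AllPairs (λ p q → ¬ (proj₂ p ≈α proj₂ q)) L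

  -- elements of A_R(∞,m) = ⊕_a A_R(∞,m,a): finitely supported families
  InSum : ∀ {m} → (Vec ℕ m → Seq m) → Set ℓ
  InSum {m} D = (∀ a → InLim a (D a))
              × Σ (List (Vec ℕ m)) (λ S → ∀ a → ¬ (a ∈ S) → ∀ n E → D a n E ≈ 0#)

  Claim1 : (m : ℕ) → Vec ℕ m → ℕ → Set (c ⊔ ℓ)
  Claim1 m a n = ∀ (F : Seq m) → InLim a F →
      ((∀ E → F n E ≈ 0#) →
         Σ (List (Rc × Alpha m)) (λ L →
            All (λ p → ∂ (proj₂ p) ≡ a × n < size (proj₂ p)) L × F ≈∞ combo L))
    × ((L : List (Rc × Alpha m)) →
         All (λ p → ∂ (proj₂ p) ≡ a × n < size (proj₂ p)) L → F ≈∞ combo L →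
         ∀ E → F n E ≈ 0#)

  -- (2) π̃_{n,a} surjective; bijective when n ≥ a_1+…+a_m
  -- (π̃_{n,a} is R-linear by construction)
  Claim2 : (m : ℕ) → Vec ℕ m → ℕ → Set (c ⊔ ℓ)
  Claim2 m a n =
      (∀ (f : Poly n m) → InvHom a f →
         Σ (Seq m) (λ F → InLim a F × (∀ E → F n E ≈ f E)))
    × (Vec.sum a ≤ n → ∀ (F G : Seq m) → InLim a F → InLim a G →
         (∀ E → F n E ≈ G n E) → F ≈∞ G)

  Claim3 : (m : ℕ) → Vec ℕ m → Set (c ⊔ ℓ)
  Claim3 m a =
      (∀ (F : Seq m) → InLim a F →
         Σ (List (Rc × Alpha m)) (λ L → All (λ p → ∂ (proj₂ p) ≡ a) L × F ≈∞ combo L))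
    × (∀ (L : List (Rc × Alpha m)) → All (λ p → ∂ (proj₂ p) ≡ a) L → Distinct L →
         (∀ n E → combo L n E ≈ 0#) → All (λ p → proj₁ p ≈ 0#) L)

  Claim4 : (m : ℕ) → Set (c ⊔ ℓ)
  Claim4 m =
      (∀ (D : Vec ℕ m → Seq m) → InSum D →
         Σ (List (Rc × Alpha m)) (λ L → ∀ a → D a ≈∞ comboAt L a))
    × (∀ (L : List (Rc × Alpha m)) → Distinct L →
         (∀ a → ∀ n E → comboAt L a n E ≈ 0#) → All (λ p → proj₁ p ≈ 0#) L)

-- A symmetric coefficient function of the exponent matrix E depends only on the
-- multiset of nonzero columns of E, because two matrices of the same width with the same such
-- multiset differ by a column permutation; compatibility with the π_n says that this
-- dependence is the same for every n. So F is one function, its profile, on the multisets of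
-- nonzero columns of total degree a. There are finitely many of these, and e_α is the
-- indicator function of α, so the e_α with ∂(e_α) = a form a basis. The projection π̃_n only
-- forgets the values at multisets with more than n elements: its kernel is spanned by the
-- e_α with |α| > n, an invariant f at level n is the image of its own profile extended by
-- zero, and for n ≥ a₁ + … + aₘ no multiset of degree a has more than n elements.

{-# OPTIONS --safe #-}
module Submission where

open import Defs
open import Level using (Level)
open import Algebra.Bundles using (CommutativeRing)
open import Data.Nat
  using (ℕ; zero; suc; _+_; _∸_; _≤_; _<_; _≤′_; ≤′-refl; ≤′-step; z≤n; s≤s; _≤?_; _<?_)
import Data.Nat.Properties as ℕ
open import Algebra.Properties.CommutativeSemigroup ℕ.+-commutativeSemigroup using (interchange)
open import Data.Nat.ListAction using () renaming (sum to sumᴸ)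
open import Data.Nat.ListAction.Properties using (sum-↭)
open import Data.Bool using (true; false; if_then_else_)
open import Data.Maybe using (just)
open import Data.Empty using (⊥-elim)
open import Data.Unit using (⊤; tt)
open import Data.Fin as Fin using (Fin)
import Data.Fin.Properties as FinP
open import Data.Fin.Permutation as Perm using (Permutation′; _⟨$⟩ʳ_; _⟨$⟩ˡ_)
open import Data.List as List using (List; []; _∷_; _++_; length; filter)
import Data.List.Properties as List
open import Data.List.Membership.Propositional using (_∈_)
open import Data.List.Membership.Propositional.Properties
  using (∈-cartesianProductWith⁺; ∈-upTo⁺; ∈-map⁺; ∈-filter⁺; ∈-concatMap⁺)
open import Data.List.Relation.Unary.All as All using (All; []; _∷_)
open import Data.List.Relation.Unary.All.Properties using (all-filter; replicate⁺)
open import Data.List.Relation.Unary.Any as Any using (here; there)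
import Data.List.Relation.Unary.Any.Properties as Any
open import Data.List.Relation.Unary.AllPairs using ([]; _∷_)
open import Data.List.Relation.Binary.Permutation.Propositional
  using (_↭_; ↭-refl; ↭-reflexive; ↭-prep; ↭-swap; ↭-sym; ↭-trans; ↭⇒↭ₛ; module PermutationReasoning)
open import Data.List.Relation.Binary.Permutation.Propositional.Properties
  using (filter-↭; map⁺; ++⁺ʳ; shift; ↭-length; ∈-resp-↭; drop-∷)
open import Data.List.Relation.Binary.Permutation.Setoid.Properties using (onIndices-lookup)
open import Data.List.Relation.Binary.Permutation.Homogeneous using (onIndices)
open import Data.List.Relation.Binary.BagAndSetEquality using (∼bag⇒↭)
open import Data.Vec as Vec using (Vec; []; _∷_; _∷ʳ_; lookup; tabulate; replicate; zipWith; toList)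
import Data.Vec.Properties as Vec
open import Data.Product using (∃; _×_; _,_; proj₁; proj₂)
open import Data.Product.Function.Dependent.Propositional using (Σ-↔)
open import Function using (_∘_; _↔_; mk↔ₛ′)
open import Function.Properties.Inverse using (↔-refl; ↔-sym; ↔-trans)
open import Relation.Nullary using (¬_; Dec; yes; no; does; ¬?; contradiction; _×-dec_)
open import Relation.Unary using (Pred; Decidable)
open import Relation.Binary.PropositionalEquality as ≡
  using (_≡_; refl; sym; trans; cong; cong₂; subst; subst₂; module ≡-Reasoning)

module _ {a} {A : Set a} where

  ∈-tabulate↔ : ∀ {n} (g : Fin n → A) {z} → z ∈ List.tabulate g ↔ ∃ λ i → z ≡ g i
  ∈-tabulate↔ g {z} = mk↔ₛ′ Any.tabulate⁻ (λ (i , q) → Any.tabulate⁺ i q) (to∘from g) (from∘to g)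
    where
    to∘from : ∀ {n} (g : Fin n → A) (p : ∃ λ i → z ≡ g i) →
              Any.tabulate⁻ {P = z ≡_} (Any.tabulate⁺ {f = g} (proj₁ p) (proj₂ p)) ≡ p
    to∘from g (Fin.zero  , _) = refl
    to∘from g (Fin.suc i , q) = cong (λ (j , r) → Fin.suc j , r) (to∘from (g ∘ Fin.suc) (i , q))
    from∘to : ∀ {n} (g : Fin n → A) (p : z ∈ List.tabulate g) →
              Any.tabulate⁺ {P = z ≡_} _ (proj₂ (Any.tabulate⁻ p)) ≡ p
    from∘to {suc n} g (here _)  = refl
    from∘to {suc n} g (there p) = cong there (from∘to (g ∘ Fin.suc) p)

  tabulate-↭ : ∀ {n} (σ : Permutation′ n) (g : Fin n → A) →
               List.tabulate (g ∘ (σ ⟨$⟩ʳ_)) ↭ List.tabulate g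
  tabulate-↭ σ g =
    ∼bag⇒↭ (↔-trans (∈-tabulate↔ _) (↔-trans (Σ-↔ σ ↔-refl) (↔-sym (∈-tabulate↔ g))))

  tabulate-↭⇒permutation : ∀ {n} (g h : Fin n → A) → List.tabulate g ↭ List.tabulate h →
                           ∃ λ (σ : Permutation′ n) → ∀ j → g (σ ⟨$⟩ʳ j) ≡ h j
  tabulate-↭⇒permutation {n} g h p = σ , σ-reindexes
    where
    open ≡-Reasoning
    |g|≡n : length (List.tabulate g) ≡ n
    |g|≡n = List.length-tabulate g
    |h|≡n : length (List.tabulate h) ≡ n
    |h|≡n = List.length-tabulate h
    ρ : Perm.Permutation (length (List.tabulate g)) (length (List.tabulate h))
    ρ = onIndices (↭⇒↭ₛ p)
    -- σ is ρ⁻¹, transported along length (tabulate g) ≡ n ≡ length (tabulate h).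
    σ : Permutation′ n
    σ = Perm.cast-id (sym |h|≡n) Perm.∘ₚ Perm.flip ρ Perm.∘ₚ Perm.cast-id |g|≡n
    σ-reindexes : ∀ j → g (σ ⟨$⟩ʳ j) ≡ h j
    σ-reindexes j = let k = Fin.cast (sym |h|≡n) j in begin
      g (σ ⟨$⟩ʳ j)
        ≡⟨ List.lookup-tabulate g (σ ⟨$⟩ʳ j) ⟨
      List.lookup (List.tabulate g) (Fin.cast _ (σ ⟨$⟩ʳ j))
        ≡⟨ cong (List.lookup (List.tabulate g)) (FinP.cast-involutive (sym |g|≡n) |g|≡n (ρ ⟨$⟩ˡ k)) ⟩
      List.lookup (List.tabulate g) (ρ ⟨$⟩ˡ k)
        ≡⟨ onIndices-lookup (≡.setoid A) (↭⇒↭ₛ p) (ρ ⟨$⟩ˡ k) ⟩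
      List.lookup (List.tabulate h) (ρ ⟨$⟩ʳ (ρ ⟨$⟩ˡ k))
        ≡⟨ cong (List.lookup (List.tabulate h)) (Perm.inverseʳ ρ) ⟩
      List.lookup (List.tabulate h) k
        ≡⟨ List.lookup-tabulate h j ⟩
      h j ∎

  vecsOver : List A → (k : ℕ) → List (Vec A k)
  vecsOver xs zero    = [] ∷ []
  vecsOver xs (suc k) = List.cartesianProductWith _∷_ xs (vecsOver xs k)

  ∈-vecsOver : ∀ {xs k} (v : Vec A k) → (∀ i → lookup v i ∈ xs) → v ∈ vecsOver xs k
  ∈-vecsOver []      _ = here refl
  ∈-vecsOver (x ∷ v) h = ∈-cartesianProductWith⁺ _∷_ (h Fin.zero) (∈-vecsOver v (h ∘ Fin.suc))

  lookup-ext : ∀ {n} {u w : Vec A n} → (∀ i → lookup u i ≡ lookup w i) → u ≡ w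
  lookup-ext {u = u} {w} h =
    trans (sym (Vec.tabulate∘lookup u)) (trans (Vec.tabulate-cong h) (Vec.tabulate∘lookup w))

  tabulate-lookup : ∀ {n} (v : Vec A n) → List.tabulate (lookup v) ≡ toList v
  tabulate-lookup []      = refl
  tabulate-lookup (x ∷ v) = cong (x ∷_) (tabulate-lookup v)

  toList-tabulate : ∀ {n} (g : Fin n → A) → toList (tabulate g) ≡ List.tabulate g
  toList-tabulate {zero}  g = refl
  toList-tabulate {suc n} g = cong (g Fin.zero ∷_) (toList-tabulate (g ∘ Fin.suc))

lookup≤sum : ∀ {k} (v : Vec ℕ k) i → lookup v i ≤ Vec.sum v
lookup≤sum (x ∷ v) Fin.zero    = ℕ.m≤m+n x _
lookup≤sum (x ∷ v) (Fin.suc i) = ℕ.≤-trans (lookup≤sum v i) (ℕ.m≤n+m _ x)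

sum-zipWith-+ : ∀ {k} (u w : Vec ℕ k) → Vec.sum (zipWith _+_ u w) ≡ Vec.sum u + Vec.sum w
sum-zipWith-+ []      []      = refl
sum-zipWith-+ (x ∷ u) (y ∷ w) = trans (cong (x + y +_) (sum-zipWith-+ u w)) (interchange x y _ _)

≢replicate⇒0<sum : ∀ {k} {v : Vec ℕ k} → ¬ v ≡ replicate k 0 → 0 < Vec.sum v
≢replicate⇒0<sum {v = []}        v≢0 = ⊥-elim (v≢0 refl)
≢replicate⇒0<sum {v = zero ∷ v}  v≢0 = ≢replicate⇒0<sum (v≢0 ∘ cong (0 ∷_))
≢replicate⇒0<sum {v = suc x ∷ v} _   = s≤s z≤n

-- Columns of exponent matrices

Columns : ℕ → Set
Columns m = List (Vec ℕ m)

module _ {m : ℕ} where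

  zeroColumn : Vec ℕ m
  zeroColumn = replicate m 0

  zeros : ℕ → Columns m
  zeros k = List.replicate k zeroColumn

  AllNonzero : Columns m → Set
  AllNonzero = All (λ c → ¬ c ≡ zeroColumn)

  nonzero : Columns m → Columns m
  nonzero = filter (λ c → ¬? (c ≟v zeroColumn))

  padWithZeros : ℕ → Columns m → Columns m
  padWithZeros n xs = xs ++ zeros (n ∸ length xs)

  nonzero-++-zeros : ∀ xs k → nonzero (xs ++ zeros k) ≡ nonzero xs
  nonzero-++-zeros xs k = begin
    nonzero (xs ++ zeros k)           ≡⟨ List.filter-++ _ xs _ ⟩
    nonzero xs ++ nonzero (zeros k)   ≡⟨ cong (nonzero xs ++_)
                                           (List.filter-none _ (replicate⁺ k λ ne → ne refl)) ⟩
    nonzero xs ++ []                  ≡⟨ List.++-identityʳ _ ⟩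
    nonzero xs                        ∎
    where open ≡-Reasoning

  ↭-padWithZeros-nonzero : ∀ xs → xs ↭ padWithZeros (length xs) (nonzero xs)
  ↭-padWithZeros-nonzero []       = ↭-refl
  ↭-padWithZeros-nonzero (c ∷ xs) with c ≟v zeroColumn
  ... | no _     = ↭-prep c (↭-padWithZeros-nonzero xs)
  ... | yes refl = begin
    zeroColumn ∷ xs                              ↭⟨ ↭-prep _ (↭-padWithZeros-nonzero xs) ⟩
    zeroColumn ∷ nonzero xs ++ zeros k           ↭⟨ shift _ (nonzero xs) _ ⟨
    nonzero xs ++ zeroColumn ∷ zeros k           ≡⟨ cong (λ i → nonzero xs ++ zeros i)
                                                      (ℕ.+-∸-assoc 1 (List.length-filter _ xs)) ⟨
    padWithZeros (suc (length xs)) (nonzero xs)  ∎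
    where
    open PermutationReasoning
    k : ℕ
    k = length xs ∸ length (nonzero xs)

  padWithZeros-↭ : ∀ n {xs ys} → xs ↭ ys → padWithZeros n xs ↭ padWithZeros n ys
  padWithZeros-↭ n {xs} p =
    subst (λ k → padWithZeros n xs ↭ _ ++ zeros (n ∸ k)) (↭-length p) (++⁺ʳ _ p)

  colsum : Columns m → Vec ℕ m
  colsum = List.foldr (zipWith _+_) zeroColumn

  lookup-colsum : ∀ xs i → lookup (colsum xs) i ≡ sumᴸ (List.map (λ c → lookup c i) xs)
  lookup-colsum []       i = Vec.lookup-replicate i 0
  lookup-colsum (c ∷ xs) i =
    trans (Vec.lookup-zipWith _+_ i c _) (cong (lookup c i +_) (lookup-colsum xs i))

  colsum-↭ : ∀ {xs ys} → xs ↭ ys → colsum xs ≡ colsum ys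
  colsum-↭ {xs} {ys} p = lookup-ext λ i →
    trans (lookup-colsum xs i) (trans (sum-↭ (map⁺ _ p)) (sym (lookup-colsum ys i)))

  colsum-nonzero : ∀ xs → colsum (nonzero xs) ≡ colsum xs
  colsum-nonzero []       = refl
  colsum-nonzero (c ∷ xs) with c ≟v zeroColumn
  ... | no _     = cong (zipWith _+_ c) (colsum-nonzero xs)
  ... | yes refl = trans (colsum-nonzero xs) (sym (Vec.zipWith-identityˡ ℕ.+-identityˡ _))

  length≤sum-colsum : ∀ {xs} → AllNonzero xs → length xs ≤ Vec.sum (colsum xs)
  length≤sum-colsum {[]}     []           = z≤n
  length≤sum-colsum {c ∷ xs} (c≢0 ∷ xs≢0) =
    subst (suc (length xs) ≤_) (sym (sum-zipWith-+ c (colsum xs)))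
      (ℕ.+-mono-≤ (≢replicate⇒0<sum c≢0) (length≤sum-colsum xs≢0))

  columnList : ∀ {n} → Expo n m → Columns m
  columnList E = List.tabulate (column E)

  fromColumns : ∀ {n} → Vec (Vec ℕ m) n → Expo n m
  fromColumns v = tabulate λ i → Vec.map (λ c → lookup c i) v

  Expo-ext : ∀ {n} {E E′ : Expo n m} → (∀ j → column E j ≡ column E′ j) → E ≡ E′
  Expo-ext {E = E} {E′} h = lookup-ext λ i → lookup-ext λ j → begin
    lookup (lookup E i) j   ≡⟨ Vec.lookup-map i _ E ⟨
    lookup (column E j) i   ≡⟨ cong (λ c → lookup c i) (h j) ⟩
    lookup (column E′ j) i  ≡⟨ Vec.lookup-map i _ E′ ⟩
    lookup (lookup E′ i) j  ∎
    where open ≡-Reasoning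

  column-fromColumns : ∀ {n} (v : Vec (Vec ℕ m) n) j → column (fromColumns v) j ≡ lookup v j
  column-fromColumns v j = lookup-ext λ i → begin
    lookup (column (fromColumns v) j) i      ≡⟨ Vec.lookup-map i _ (fromColumns v) ⟩
    lookup (lookup (fromColumns v) i) j      ≡⟨ cong (λ r → lookup r j) (Vec.lookup∘tabulate _ i) ⟩
    lookup (Vec.map (λ c → lookup c i) v) j  ≡⟨ Vec.lookup-map j _ v ⟩
    lookup (lookup v j) i                    ∎
    where open ≡-Reasoning

  fromColumns-columns : ∀ {n} (E : Expo n m) → fromColumns (tabulate (column E)) ≡ E
  fromColumns-columns E = Expo-ext λ j → trans (column-fromColumns _ j) (Vec.lookup∘tabulate _ j)

  columnList-fromColumns : ∀ {n} (v : Vec (Vec ℕ m) n) → columnList (fromColumns v) ≡ toList v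
  columnList-fromColumns v = trans (List.tabulate-cong (column-fromColumns v)) (tabulate-lookup v)

  column-permExpo : ∀ {n} (σ : Permutation′ n) (E : Expo n m) j →
                    column (permExpo σ E) j ≡ column E (σ ⟨$⟩ʳ j)
  column-permExpo σ E j =
    trans (sym (Vec.map-∘ _ _ E)) (Vec.map-cong (λ row → Vec.lookup∘tabulate _ j) E)

  extendExpo-fromColumns : ∀ {n} (v : Vec (Vec ℕ m) n) →
                           extendExpo (fromColumns v) ≡ fromColumns (v ∷ʳ zeroColumn)
  extendExpo-fromColumns v = lookup-ext λ i → begin
    lookup (extendExpo (fromColumns v)) i                ≡⟨ Vec.lookup-map i _ (fromColumns v) ⟩
    lookup (fromColumns v) i ∷ʳ 0                        ≡⟨ cong (_∷ʳ 0) (Vec.lookup∘tabulate _ i) ⟩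
    Vec.map (λ c → lookup c i) v ∷ʳ 0                    ≡⟨ cong (Vec.map (λ c → lookup c i) v ∷ʳ_)
                                                              (Vec.lookup-replicate i 0) ⟨
    Vec.map (λ c → lookup c i) v ∷ʳ lookup zeroColumn i  ≡⟨ Vec.map-∷ʳ (λ c → lookup c i) zeroColumn v ⟨
    Vec.map (λ c → lookup c i) (v ∷ʳ zeroColumn)         ≡⟨ Vec.lookup∘tabulate _ i ⟨
    lookup (fromColumns (v ∷ʳ zeroColumn)) i             ∎
    where open ≡-Reasoning

  columnList-extendExpo : ∀ {n} (E : Expo n m) → columnList (extendExpo E) ≡ columnList E ++ zeros 1
  columnList-extendExpo {n} E = begin
    columnList (extendExpo E)                   ≡⟨ cong (columnList ∘ extendExpo) (fromColumns-columns E) ⟨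
    columnList (extendExpo (fromColumns v))     ≡⟨ cong columnList (extendExpo-fromColumns v) ⟩
    columnList (fromColumns (v ∷ʳ zeroColumn))  ≡⟨ columnList-fromColumns _ ⟩
    toList (v ∷ʳ zeroColumn)                    ≡⟨ Vec.toList-∷ʳ zeroColumn v ⟩
    toList v ++ zeros 1                         ≡⟨ cong (_++ zeros 1) (toList-tabulate (column E)) ⟩
    columnList E ++ zeros 1                     ∎
    where
    open ≡-Reasoning
    v : Vec (Vec ℕ m) n
    v = tabulate (column E)

  nonzeroColumns-columnList : ∀ {n} (E : Expo n m) → nonzeroColumns E ≡ nonzero (columnList E)
  nonzeroColumns-columnList {n} E = go (λ j → j)
    where
    go : ∀ {k} (g : Fin k → Fin n) →
         List.foldr (λ j acc → if isZeroVec (column E j) then acc else column E j ∷ acc) [] (List.tabulate g)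
         ≡ nonzero (List.tabulate (column E ∘ g))
    go {zero}  g = refl
    go {suc k} g with column E (g Fin.zero) ≟v zeroColumn
    ... | yes _ = go (g ∘ Fin.suc)
    ... | no _  = cong (column E (g Fin.zero) ∷_) (go (g ∘ Fin.suc))

  nonzeroColumns-nonzero : ∀ {n} (E : Expo n m) → AllNonzero (nonzeroColumns E)
  nonzeroColumns-nonzero E =
    subst (All _) (sym (nonzeroColumns-columnList E)) (all-filter _ (columnList E))

  length-nonzeroColumns≤width : ∀ {n} (E : Expo n m) → length (nonzeroColumns E) ≤ n
  length-nonzeroColumns≤width E = subst₂ _≤_ (cong length (sym (nonzeroColumns-columnList E)))
    (List.length-tabulate (column E)) (List.length-filter _ (columnList E))

  nonzeroColumns-extendExpo : ∀ {n} (E : Expo n m) → nonzeroColumns (extendExpo E) ≡ nonzeroColumns E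
  nonzeroColumns-extendExpo E = begin
    nonzeroColumns (extendExpo E)        ≡⟨ nonzeroColumns-columnList (extendExpo E) ⟩
    nonzero (columnList (extendExpo E))  ≡⟨ cong nonzero (columnList-extendExpo E) ⟩
    nonzero (columnList E ++ zeros 1)    ≡⟨ nonzero-++-zeros (columnList E) 1 ⟩
    nonzero (columnList E)               ≡⟨ nonzeroColumns-columnList E ⟨
    nonzeroColumns E                     ∎
    where open ≡-Reasoning

  nonzeroColumns-permExpo : ∀ {n} (σ : Permutation′ n) (E : Expo n m) →
                            nonzeroColumns (permExpo σ E) ↭ nonzeroColumns E
  nonzeroColumns-permExpo σ E = begin
    nonzeroColumns (permExpo σ E)                    ≡⟨ nonzeroColumns-columnList (permExpo σ E) ⟩
    nonzero (columnList (permExpo σ E))              ≡⟨ cong nonzero (List.tabulate-cong (column-permExpo σ E)) ⟩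
    nonzero (List.tabulate (column E ∘ (σ ⟨$⟩ʳ_)))  ↭⟨ filter-↭ _ (tabulate-↭ σ (column E)) ⟩
    nonzero (columnList E)                           ≡⟨ nonzeroColumns-columnList E ⟨
    nonzeroColumns E                                 ∎
    where open PermutationReasoning

  columnList-↭-padWithZeros : ∀ {n} (E : Expo n m) → columnList E ↭ padWithZeros n (nonzeroColumns E)
  columnList-↭-padWithZeros {n} E = begin
    columnList E                                                   ↭⟨ ↭-padWithZeros-nonzero (columnList E) ⟩
    padWithZeros (length (columnList E)) (nonzero (columnList E))  ≡⟨ cong₂ padWithZeros
                                                                        (List.length-tabulate (column E))
                                                                        (sym (nonzeroColumns-columnList E)) ⟩
    padWithZeros n (nonzeroColumns E)                              ∎
    where open PermutationReasoning

  nonzeroColumns-↭⇒permExpo : ∀ {n} {E E′ : Expo n m} → nonzeroColumns E ↭ nonzeroColumns E′ →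
                              ∃ λ σ → permExpo σ E ≡ E′
  nonzeroColumns-↭⇒permExpo {n} {E} {E′} p =
    let σ , σ-reindexes = tabulate-↭⇒permutation (column E) (column E′) columnList↭
    in σ , Expo-ext λ j → trans (column-permExpo σ E j) (σ-reindexes j)
    where
    open PermutationReasoning
    columnList↭ : columnList E ↭ columnList E′
    columnList↭ = begin
      columnList E                        ↭⟨ columnList-↭-padWithZeros E ⟩
      padWithZeros n (nonzeroColumns E)   ↭⟨ padWithZeros-↭ n p ⟩
      padWithZeros n (nonzeroColumns E′)  ↭⟨ columnList-↭-padWithZeros E′ ⟨
      columnList E′                       ∎

  padded : (n : ℕ) → Columns m → Vec (Vec ℕ m) n
  padded zero    _        = []
  padded (suc n) []       = zeroColumn ∷ padded n []
  padded (suc n) (c ∷ cs) = c ∷ padded n cs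

  toList-padded : ∀ n {xs} → length xs ≤ n → toList (padded n xs) ≡ padWithZeros n xs
  toList-padded zero    {[]}     _        = refl
  toList-padded (suc n) {[]}     _        = cong (zeroColumn ∷_) (toList-padded n z≤n)
  toList-padded (suc n) {c ∷ xs} (s≤s le) = cong (c ∷_) (toList-padded n le)

  padded-suc : ∀ n {xs} → length xs ≤ n → padded (suc n) xs ≡ padded n xs ∷ʳ zeroColumn
  padded-suc zero    {[]}     _        = refl
  padded-suc (suc n) {[]}     _        = cong (zeroColumn ∷_) (padded-suc n z≤n)
  padded-suc (suc n) {c ∷ xs} (s≤s le) = cong (c ∷_) (padded-suc n le)

  realise : (n : ℕ) → Columns m → Expo n m
  realise n xs = fromColumns (padded n xs)

  extendExpo-realise : ∀ {n} xs → length xs ≤ n → extendExpo (realise n xs) ≡ realise (suc n) xs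
  extendExpo-realise {n} xs le =
    trans (extendExpo-fromColumns (padded n xs)) (cong fromColumns (sym (padded-suc n le)))

  nonzeroColumns-realise : ∀ {n} xs → length xs ≤ n → nonzeroColumns (realise n xs) ≡ nonzero xs
  nonzeroColumns-realise {n} xs le = begin
    nonzeroColumns (realise n xs)        ≡⟨ nonzeroColumns-columnList (realise n xs) ⟩
    nonzero (columnList (realise n xs))  ≡⟨ cong nonzero (columnList-fromColumns (padded n xs)) ⟩
    nonzero (toList (padded n xs))       ≡⟨ cong nonzero (toList-padded n le) ⟩
    nonzero (padWithZeros n xs)          ≡⟨ nonzero-++-zeros xs _ ⟩
    nonzero xs                           ∎
    where open ≡-Reasoning

  nonzeroColumns-realise-↭ : ∀ {n xs ys} → xs ↭ ys → length xs ≤ n →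
                             nonzeroColumns (realise n xs) ↭ nonzeroColumns (realise n ys)
  nonzeroColumns-realise-↭ {n} {xs} {ys} p le = begin
    nonzeroColumns (realise n xs)  ≡⟨ nonzeroColumns-realise xs le ⟩
    nonzero xs                     ↭⟨ filter-↭ _ p ⟩
    nonzero ys                     ≡⟨ nonzeroColumns-realise ys (subst (_≤ n) (↭-length p) le) ⟨
    nonzeroColumns (realise n ys)  ∎
    where open PermutationReasoning

  nonzeroColumns-realise-nonzero : ∀ {n xs} → AllNonzero xs → length xs ≤ n →
                                   nonzeroColumns (realise n xs) ≡ xs
  nonzeroColumns-realise-nonzero {xs = xs} xs≢0 le =
    trans (nonzeroColumns-realise xs le) (List.filter-all _ xs≢0)

  nonzeroColumns-surjective : ∀ {xs} → AllNonzero xs →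
                              ∃ λ n → ∃ λ (E : Expo n m) → nonzeroColumns E ≡ xs
  nonzeroColumns-surjective {xs} xs≢0 =
    length xs , realise (length xs) xs , nonzeroColumns-realise-nonzero xs≢0 ℕ.≤-refl

  mdeg-fromColumns : ∀ {n} (v : Vec (Vec ℕ m) n) → mdeg (fromColumns v) ≡ colsum (toList v)
  mdeg-fromColumns v = lookup-ext λ i →
    trans (Vec.lookup-map i Vec.sum (fromColumns v))
          (trans (cong Vec.sum (Vec.lookup∘tabulate _ i)) (rowsum v i))
    where
    rowsum : ∀ {n} (v : Vec (Vec ℕ m) n) i →
             Vec.sum (Vec.map (λ c → lookup c i) v) ≡ lookup (colsum (toList v)) i
    rowsum []      i = sym (Vec.lookup-replicate i 0)
    rowsum (c ∷ v) i = trans (cong (lookup c i +_) (rowsum v i)) (sym (Vec.lookup-zipWith _+_ i c _))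

  mdeg-colsum : ∀ {n} (E : Expo n m) → mdeg E ≡ colsum (nonzeroColumns E)
  mdeg-colsum {n} E = begin
    mdeg E                           ≡⟨ cong mdeg (fromColumns-columns E) ⟨
    mdeg (fromColumns v)             ≡⟨ mdeg-fromColumns v ⟩
    colsum (toList v)                ≡⟨ cong colsum (toList-tabulate (column E)) ⟩
    colsum (columnList E)            ≡⟨ colsum-nonzero (columnList E) ⟨
    colsum (nonzero (columnList E))  ≡⟨ cong colsum (nonzeroColumns-columnList E) ⟨
    colsum (nonzeroColumns E)        ∎
    where
    open ≡-Reasoning
    v : Vec (Vec ℕ m) n
    v = tabulate (column E)

  mdeg-realise : ∀ {n xs} → length xs ≤ n → mdeg (realise n xs) ≡ colsum xs
  mdeg-realise {n} {xs} le = trans (mdeg-colsum (realise n xs))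
    (trans (cong colsum (nonzeroColumns-realise xs le)) (colsum-nonzero xs))

  length-nonzeroColumns≤degree : ∀ {n} (E : Expo n m) → length (nonzeroColumns E) ≤ Vec.sum (mdeg E)
  length-nonzeroColumns≤degree E = subst (λ a → length (nonzeroColumns E) ≤ Vec.sum a)
    (sym (mdeg-colsum E)) (length≤sum-colsum (nonzeroColumns-nonzero E))

  entry≤degree : ∀ {n} (E : Expo n m) i j → lookup (lookup E i) j ≤ Vec.sum (mdeg E)
  entry≤degree E i j = ℕ.≤-trans (lookup≤sum (lookup E i) j)
    (subst (_≤ Vec.sum (mdeg E)) (Vec.lookup-map i Vec.sum E) (lookup≤sum (mdeg E) i))

  matrices : (B n : ℕ) → List (Expo n m)
  matrices B n = vecsOver (vecsOver (List.upTo (suc B)) n) m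

  ∈-matrices : ∀ {n} (E : Expo n m) → E ∈ matrices (Vec.sum (mdeg E)) n
  ∈-matrices E =
    ∈-vecsOver E λ i → ∈-vecsOver (lookup E i) λ j → ∈-upTo⁺ (s≤s (entry≤degree E i j))

  candidates : ℕ → List (Alpha m)
  candidates N = List.map (λ E → nonzeroColumns E , nonzeroColumns-nonzero E) (matrices N N)

  ∈-candidates : ∀ {xs} → AllNonzero xs → ∃ λ α → α ∈ candidates (Vec.sum (colsum xs)) × monos α ≡ xs
  ∈-candidates {xs} xs≢0 =
    (nonzeroColumns E , nonzeroColumns-nonzero E) ,
    ∈-map⁺ _ (subst (λ a → E ∈ matrices (Vec.sum a) N) (mdeg-realise le) (∈-matrices E)) ,
    nonzeroColumns-realise-nonzero xs≢0 le
    where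
    N : ℕ
    N = Vec.sum (colsum xs)
    le : length xs ≤ N
    le = length≤sum-colsum xs≢0
    E : Expo N m
    E = realise N xs

  removeOne⇒↭ : ∀ (v : Vec ℕ m) ys {ys′} → removeOne v ys ≡ just ys′ → ys ↭ v ∷ ys′
  removeOne⇒↭ v (w ∷ ws) eq with v ≟v w
  removeOne⇒↭ v (w ∷ ws) refl | yes refl = ↭-refl
  ... | no _ with removeOne v ws in eq′
  removeOne⇒↭ v (w ∷ ws) refl | no _ | just ws′ =
    ↭-trans (↭-prep w (removeOne⇒↭ v ws eq′)) (↭-swap w v ↭-refl)

  ∈⇒removeOne : ∀ (v : Vec ℕ m) ys → v ∈ ys → ∃ λ ys′ → removeOne v ys ≡ just ys′
  ∈⇒removeOne v (w ∷ ws) v∈ with v ≟v w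
  ... | yes _ = ws , refl
  ∈⇒removeOne v (w ∷ ws) (here v≡w)  | no v≢w = ⊥-elim (v≢w v≡w)
  ∈⇒removeOne v (w ∷ ws) (there v∈) | no _ with ∈⇒removeOne v ws v∈
  ... | ws′ , eq rewrite eq = w ∷ ws′ , refl

  bagEq⇒↭ : ∀ (xs ys : Columns m) → bagEq xs ys ≡ true → xs ↭ ys
  bagEq⇒↭ []       []  _  = ↭-refl
  bagEq⇒↭ (x ∷ xs) ys eq with removeOne x ys in eq′
  ... | just ys′ = ↭-trans (↭-prep x (bagEq⇒↭ xs ys′ eq)) (↭-sym (removeOne⇒↭ x ys eq′))

  ↭⇒bagEq : ∀ (xs ys : Columns m) → xs ↭ ys → bagEq xs ys ≡ true
  ↭⇒bagEq []       []       _ = refl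
  ↭⇒bagEq []       (y ∷ ys) p with () ← ↭-length p
  ↭⇒bagEq (x ∷ xs) ys       p with ∈⇒removeOne x ys (∈-resp-↭ p (here refl))
  ... | ys′ , eq with removeOne x ys | eq
  ... | just .ys′ | refl = ↭⇒bagEq xs ys′ (drop-∷ (↭-trans p (removeOne⇒↭ x ys eq)))

-- The inverse limit and the elements e_α

module _ {c ℓ : Level} (R : CommutativeRing c ℓ) {m : ℕ} where

  open CommutativeRing R
    using (_≈_; 0#; 1#; -_; setoid; +-cong; +-congˡ; +-congʳ; *-congʳ;
           +-identityˡ; +-identityʳ; *-identityʳ; zeroˡ; zeroʳ; +-group)
    renaming (Carrier to Rc; _+_ to _+ᴿ_; _*_ to _*ᴿ_;
              refl to ≈-refl; sym to ≈-sym; trans to ≈-trans; reflexive to ≈-reflexive)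
  open import Algebra.Properties.Group +-group using (//-rightDividesˡ; x≈y⇒x∙y⁻¹≈ε)
  open import Relation.Binary.Reasoning.Setoid setoid
  open WithRing R
  open import Data.List.Membership.DecPropositional (_≟v_ {m}) using (_∈?_)

  _↭?_ : (xs ys : Columns m) → Dec (xs ↭ ys)
  xs ↭? ys with bagEq xs ys in eq
  ... | true  = yes (bagEq⇒↭ xs ys eq)
  ... | false = no λ p → contradiction (trans (sym (↭⇒bagEq xs ys p)) eq) λ ()

  -- indicator α, lincomb L and lincombAt L a are eCoeff α n, combo L n and comboAt L a n
  -- read off the nonzero columns: combo L n E is definitionally lincomb L (nonzeroColumns E).

  indicator : Alpha m → Columns m → Rc
  indicator α xs = if bagEq xs (monos α) then 1# else 0#

  indicator-↭ : ∀ α {xs} → xs ↭ monos α → indicator α xs ≡ 1#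
  indicator-↭ α {xs} p rewrite ↭⇒bagEq xs (monos α) p = refl

  indicator-≁ : ∀ α {xs} → ¬ (xs ↭ monos α) → indicator α xs ≡ 0#
  indicator-≁ α {xs} ¬p with bagEq xs (monos α) in eq
  ... | true  = contradiction (bagEq⇒↭ xs (monos α) eq) ¬p
  ... | false = refl

  indicator-resp-↭ : ∀ α {xs ys} → xs ↭ ys → indicator α xs ≡ indicator α ys
  indicator-resp-↭ α {xs} p with xs ↭? monos α
  ... | yes q = trans (indicator-↭ α q) (sym (indicator-↭ α (↭-trans (↭-sym p) q)))
  ... | no ¬q = trans (indicator-≁ α ¬q) (sym (indicator-≁ α (¬q ∘ ↭-trans p)))

  indicator-off-degree : ∀ α xs → ¬ colsum xs ≡ ∂ α → indicator α xs ≡ 0#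
  indicator-off-degree α xs deg≢ = indicator-≁ α {xs} (deg≢ ∘ colsum-↭)

  lincomb : List (Rc × Alpha m) → Columns m → Rc
  lincomb L xs = List.foldr (λ p acc → proj₁ p *ᴿ indicator (proj₂ p) xs +ᴿ acc) 0# L

  lincombAt : List (Rc × Alpha m) → Vec ℕ m → Columns m → Rc
  lincombAt L a xs = List.foldr
    (λ p acc → (if does (∂ (proj₂ p) ≟v a) then proj₁ p *ᴿ indicator (proj₂ p) xs else 0#) +ᴿ acc) 0# L

  lincomb-resp-↭ : ∀ L {xs ys} → xs ↭ ys → lincomb L xs ≡ lincomb L ys
  lincomb-resp-↭ []            p = refl
  lincomb-resp-↭ ((r , α) ∷ L) p =
    cong₂ (λ i s → r *ᴿ i +ᴿ s) (indicator-resp-↭ α p) (lincomb-resp-↭ L p)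

  lincomb-vanishes : ∀ L xs → All (λ p → ¬ (xs ↭ monos (proj₂ p))) L → lincomb L xs ≈ 0#
  lincomb-vanishes []            xs []         = ≈-refl
  lincomb-vanishes ((r , α) ∷ L) xs (¬p ∷ ¬ps) = begin
    r *ᴿ indicator α xs +ᴿ lincomb L xs  ≡⟨ cong (λ i → r *ᴿ i +ᴿ lincomb L xs) (indicator-≁ α ¬p) ⟩
    r *ᴿ 0# +ᴿ lincomb L xs              ≈⟨ +-cong (zeroʳ r) (lincomb-vanishes L xs ¬ps) ⟩
    0# +ᴿ 0#                             ≈⟨ +-identityˡ 0# ⟩
    0#                                   ∎

  lincombAt-degree : ∀ L a xs → colsum xs ≡ a → lincombAt L a xs ≈ lincomb L xs
  lincombAt-degree []            _ _  _   = ≈-refl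
  lincombAt-degree ((r , α) ∷ L) a xs deg with ∂ α ≟v a
  ... | yes _    = +-congˡ (lincombAt-degree L a xs deg)
  ... | no ∂α≢a = begin
    0# +ᴿ lincombAt L a xs               ≈⟨ +-cong (zeroʳ r) (≈-sym (lincombAt-degree L a xs deg)) ⟨
    r *ᴿ 0# +ᴿ lincomb L xs              ≡⟨ cong (λ i → r *ᴿ i +ᴿ lincomb L xs)
                                              (indicator-off-degree α xs λ e → ∂α≢a (trans (sym e) deg)) ⟨
    r *ᴿ indicator α xs +ᴿ lincomb L xs  ∎

  lincombAt-off-degree : ∀ L a xs → ¬ colsum xs ≡ a → lincombAt L a xs ≈ 0#
  lincombAt-off-degree []            _ _  _    = ≈-refl
  lincombAt-off-degree ((r , α) ∷ L) a xs deg≢ with ∂ α ≟v a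
  ... | no _     = ≈-trans (+-identityˡ _) (lincombAt-off-degree L a xs deg≢)
  ... | yes ∂α≡a = begin
    r *ᴿ indicator α xs +ᴿ lincombAt L a xs  ≡⟨ cong (λ i → r *ᴿ i +ᴿ lincombAt L a xs)
                                                  (indicator-off-degree α xs λ e → deg≢ (trans e ∂α≡a)) ⟩
    r *ᴿ 0# +ᴿ lincombAt L a xs              ≈⟨ +-cong (zeroʳ r) (lincombAt-off-degree L a xs deg≢) ⟩
    0# +ᴿ 0#                                 ≈⟨ +-identityˡ 0# ⟩
    0#                                       ∎

  lincomb-independent : ∀ L → Distinct L → (∀ xs → AllNonzero xs → lincomb L xs ≈ 0#) →
                        All (λ p → proj₁ p ≈ 0#) L
  lincomb-independent []            _                  _   = []
  lincomb-independent ((r , α) ∷ L) (α∉L ∷ L-distinct) L≈0 =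
    r≈0 ∷ lincomb-independent L L-distinct λ xs xs≢0 → ≈-trans (≈-sym (head-vanishes xs)) (L≈0 xs xs≢0)
    where
    r≈0 : r ≈ 0#
    r≈0 = begin
      r                                                  ≈⟨ *-identityʳ r ⟨
      r *ᴿ 1#                                            ≡⟨ cong (r *ᴿ_) (indicator-↭ α ↭-refl) ⟨
      r *ᴿ indicator α (monos α)                         ≈⟨ +-identityʳ _ ⟨
      r *ᴿ indicator α (monos α) +ᴿ 0#                   ≈⟨ +-congˡ (lincomb-vanishes L (monos α) α∉L) ⟨
      r *ᴿ indicator α (monos α) +ᴿ lincomb L (monos α)  ≈⟨ L≈0 (monos α) (proj₂ α) ⟩
      0#                                                 ∎
    head-vanishes : ∀ xs → r *ᴿ indicator α xs +ᴿ lincomb L xs ≈ lincomb L xs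
    head-vanishes xs = ≈-trans (+-congʳ (≈-trans (*-congʳ r≈0) (zeroˡ _))) (+-identityˡ _)

  vanishes-on-nonzero : ∀ (h : Columns m → Rc) → (∀ n (E : Expo n m) → h (nonzeroColumns E) ≈ 0#) →
                        ∀ xs → AllNonzero xs → h xs ≈ 0#
  vanishes-on-nonzero h h≈0 xs xs≢0 = let n , E , nzE≡xs = nonzeroColumns-surjective xs≢0 in
    ≈-trans (≈-reflexive (cong h (sym nzE≡xs))) (h≈0 n E)

  module Interpolation (Φ : Columns m → Rc) (Φ-resp-↭ : ∀ {xs ys} → xs ↭ ys → Φ xs ≈ Φ ys) where

    -- Each coefficient corrects the value at its own index, so an index that repeats an
    -- earlier one up to permutation gets coefficient 0: the candidates need no deduplication.
    interpolant : List (Alpha m) → List (Rc × Alpha m)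
    interpolant []       = []
    interpolant (α ∷ αs) = (Φ (monos α) +ᴿ - lincomb (interpolant αs) (monos α) , α) ∷ interpolant αs

    interpolant⁺ : ∀ {p} {P : Pred (Alpha m) p} {αs} → All P αs → All (P ∘ proj₂) (interpolant αs)
    interpolant⁺ []         = []
    interpolant⁺ (Pα ∷ Pαs) = Pα ∷ interpolant⁺ Pαs

    interpolant-agrees : ∀ {α αs} → α ∈ αs → Φ (monos α) ≈ lincomb (interpolant αs) (monos α)
    interpolant-agrees {α} {_ ∷ αs} (here refl) = begin
      Φ x                                   ≈⟨ //-rightDividesˡ (lincomb L x) (Φ x) ⟨
      head +ᴿ lincomb L x                   ≈⟨ +-congʳ (*-identityʳ head) ⟨
      head *ᴿ 1# +ᴿ lincomb L x             ≡⟨ cong (λ i → head *ᴿ i +ᴿ lincomb L x)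
                                                  (indicator-↭ α ↭-refl) ⟨
      head *ᴿ indicator α x +ᴿ lincomb L x  ∎
      where
      x : Columns m
      x = monos α
      L : List (Rc × Alpha m)
      L = interpolant αs
      head : Rc
      head = Φ x +ᴿ - lincomb L x
    interpolant-agrees {α} {β ∷ αs} (there α∈αs) = begin
      Φ x                                   ≈⟨ agrees ⟩
      lincomb L x                           ≈⟨ +-identityˡ _ ⟨
      0# +ᴿ lincomb L x                     ≈⟨ +-congʳ head-term-vanishes ⟨
      head *ᴿ indicator β x +ᴿ lincomb L x  ∎
      where
      x : Columns m
      x = monos α
      L : List (Rc × Alpha m)
      L = interpolant αs
      head : Rc
      head = Φ (monos β) +ᴿ - lincomb L (monos β)
      agrees : Φ x ≈ lincomb L x
      agrees = interpolant-agrees α∈αs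
      head-term-vanishes : head *ᴿ indicator β x ≈ 0#
      head-term-vanishes with x ↭? monos β
      ... | no ¬p = ≈-trans (≈-reflexive (cong (head *ᴿ_) (indicator-≁ β ¬p))) (zeroʳ head)
      ... | yes p = ≈-trans (*-congʳ (x≈y⇒x∙y⁻¹≈ε (begin
          Φ (monos β)          ≈⟨ Φ-resp-↭ p ⟨
          Φ x                  ≈⟨ agrees ⟩
          lincomb L x          ≡⟨ lincomb-resp-↭ L p ⟩
          lincomb L (monos β)  ∎))) (zeroˡ _)

    interpolation : ∀ {p} {P : Pred (Columns m) p} → Decidable P →
                    (∀ {xs ys} → xs ↭ ys → P ys → P xs) → (αs : List (Alpha m)) →
                    (∀ xs → AllNonzero xs → P xs → ∃ λ α → α ∈ αs × monos α ≡ xs) →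
                    (∀ xs → AllNonzero xs → ¬ P xs → Φ xs ≈ 0#) →
                    ∃ λ L → All (P ∘ monos ∘ proj₂) L × (∀ xs → AllNonzero xs → Φ xs ≈ lincomb L xs)
    interpolation {P = P} P? P-resp-↭ αs covers vanishes = L , L-in-P , agrees
      where
      L : List (Rc × Alpha m)
      L = interpolant (filter (P? ∘ monos) αs)
      L-in-P : All (P ∘ monos ∘ proj₂) L
      L-in-P = interpolant⁺ (all-filter (P? ∘ monos) αs)
      agrees : ∀ xs → AllNonzero xs → Φ xs ≈ lincomb L xs
      agrees xs xs≢0 with P? xs
      ... | yes Pxs = let α , α∈αs , monos-α≡xs = covers xs xs≢0 Pxs in begin
        Φ xs                 ≡⟨ cong Φ monos-α≡xs ⟨
        Φ (monos α)          ≈⟨ interpolant-agrees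
                                  (∈-filter⁺ (P? ∘ monos) α∈αs (subst P (sym monos-α≡xs) Pxs)) ⟩
        lincomb L (monos α)  ≡⟨ cong (lincomb L) monos-α≡xs ⟩
        lincomb L xs         ∎
      ... | no ¬Pxs = ≈-trans (vanishes xs xs≢0 ¬Pxs)
        (≈-sym (lincomb-vanishes L xs (All.map (λ Pα p → ¬Pxs (P-resp-↭ p Pα)) L-in-P)))

  open Interpolation using (interpolation)

  symmetric-resp-nonzeroColumns : ∀ {n} {f : Poly n m} → Sym f → ∀ {E E′} →
                                  nonzeroColumns E ↭ nonzeroColumns E′ → f E ≈ f E′
  symmetric-resp-nonzeroColumns {f = f} f-sym {E} p = let σ , σE≡E′ = nonzeroColumns-↭⇒permExpo p in
    ≈-trans (≈-sym (f-sym σ E)) (≈-reflexive (cong f σE≡E′))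

  symmetric-realise : ∀ {n} {f : Poly n m} → Sym f → ∀ E → f E ≈ f (realise n (nonzeroColumns E))
  symmetric-realise f-sym E = symmetric-resp-nonzeroColumns f-sym (↭-reflexive (sym
    (nonzeroColumns-realise-nonzero (nonzeroColumns-nonzero E) (length-nonzeroColumns≤width E))))

  symmetric-realise-↭ : ∀ {n} {f : Poly n m} → Sym f → ∀ {xs ys} → xs ↭ ys → length xs ≤ n →
                        f (realise n xs) ≈ f (realise n ys)
  symmetric-realise-↭ f-sym p le = symmetric-resp-nonzeroColumns f-sym (nonzeroColumns-realise-↭ p le)

  profile : Seq m → Columns m → Rc
  profile F xs = F (length xs) (realise (length xs) xs)

  profile-homogeneous : ∀ {a F} → (∀ n → Homog a (F n)) → ∀ {xs} → ¬ colsum xs ≡ a → profile F xs ≈ 0#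
  profile-homogeneous F-hom {xs} deg≢a =
    F-hom (length xs) (realise (length xs) xs) (deg≢a ∘ trans (sym (mdeg-realise ℕ.≤-refl)))

  module Profile {F : Seq m} (F-sym : ∀ n → Sym (F n)) (F-π : ∀ n E → π (F (suc n)) E ≈ F n E) where

    profile-step : ∀ {n xs} → length xs ≤ n → F (suc n) (realise (suc n) xs) ≈ F n (realise n xs)
    profile-step {n} {xs} le =
      ≈-trans (≈-reflexive (cong (F (suc n)) (sym (extendExpo-realise xs le)))) (F-π n (realise n xs))

    profile-at : ∀ {n xs} → length xs ≤′ n → F n (realise n xs) ≈ profile F xs
    profile-at ≤′-refl        = ≈-refl
    profile-at (≤′-step le′) = ≈-trans (profile-step (ℕ.≤′⇒≤ le′)) (profile-at le′)

    F≈profile : ∀ {n} E → F n E ≈ profile F (nonzeroColumns E)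
    F≈profile {n} E =
      ≈-trans (symmetric-realise (F-sym n) E) (profile-at (ℕ.≤⇒≤′ (length-nonzeroColumns≤width E)))

    profile-resp-↭ : ∀ {xs ys} → xs ↭ ys → profile F xs ≈ profile F ys
    profile-resp-↭ {xs} p = ≈-trans (symmetric-realise-↭ (F-sym (length xs)) p ℕ.≤-refl)
                                    (profile-at (ℕ.≤⇒≤′ (ℕ.≤-reflexive (sym (↭-length p)))))

  e-spans-restricted : ∀ {a F} → InLim a F → ∀ {q} {Q : Pred (Columns m) q} → Decidable Q →
                       (∀ {xs ys} → xs ↭ ys → Q ys → Q xs) →
                       (∀ xs → AllNonzero xs → colsum xs ≡ a → ¬ Q xs → profile F xs ≈ 0#) →
                       ∃ λ L → All (λ p → ∂ (proj₂ p) ≡ a × Q (monos (proj₂ p))) L × F ≈∞ combo L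
  e-spans-restricted {a} {F} (F-inv , F-π) {q} {Q} Q? Q-resp-↭ Q-vanishes =
    let L , L-in-P , agrees = interpolation (profile F) profile-resp-↭ P? P-resp-↭ (candidates (Vec.sum a))
                                            covers vanishes
    in L , L-in-P , λ n E → ≈-trans (F≈profile E) (agrees (nonzeroColumns E) (nonzeroColumns-nonzero E))
    where
    open Profile (proj₂ ∘ F-inv) F-π
    P : Pred (Columns m) q
    P xs = colsum xs ≡ a × Q xs
    P? : Decidable P
    P? xs = colsum xs ≟v a ×-dec Q? xs
    P-resp-↭ : ∀ {xs ys} → xs ↭ ys → P ys → P xs
    P-resp-↭ p (deg , Qys) = trans (colsum-↭ p) deg , Q-resp-↭ p Qys
    covers : ∀ xs → AllNonzero xs → P xs → ∃ λ α → α ∈ candidates (Vec.sum a) × monos α ≡ xs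
    covers xs xs≢0 (deg , _) =
      subst (λ b → ∃ λ α → α ∈ candidates (Vec.sum b) × monos α ≡ xs) deg (∈-candidates xs≢0)
    vanishes : ∀ xs → AllNonzero xs → ¬ P xs → profile F xs ≈ 0#
    vanishes xs xs≢0 ¬Pxs with colsum xs ≟v a
    ... | yes deg  = Q-vanishes xs xs≢0 deg (¬Pxs ∘ (deg ,_))
    ... | no deg≢a = profile-homogeneous (proj₁ ∘ F-inv) deg≢a

  ker-π̃ : ∀ a n → Claim1 m a n
  ker-π̃ a n F F∈@(F-inv , F-π) = spanned , vanishes
    where
    open Profile (proj₂ ∘ F-inv) F-π
    spanned : (∀ E → F n E ≈ 0#) →
              ∃ λ L → All (λ p → ∂ (proj₂ p) ≡ a × n < size (proj₂ p)) L × F ≈∞ combo L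
    spanned Fn≈0 = e-spans-restricted F∈ (λ xs → n <? length xs) (λ p → subst (n <_) (sym (↭-length p)))
      λ xs _ _ n≮len → ≈-trans (≈-sym (profile-at (ℕ.≤⇒≤′ (ℕ.≮⇒≥ n≮len)))) (Fn≈0 (realise n xs))
    vanishes : ∀ L → All (λ p → ∂ (proj₂ p) ≡ a × n < size (proj₂ p)) L → F ≈∞ combo L →
               ∀ E → F n E ≈ 0#
    vanishes L L-in-ker F≈L E = ≈-trans (F≈L n E) (lincomb-vanishes L (nonzeroColumns E) (All.map
      (λ (_ , n<size) p → ℕ.<⇒≱ n<size (subst (_≤ n) (↭-length p) (length-nonzeroColumns≤width E)))
      L-in-ker))

  restrictedProfile : (n : ℕ) → Poly n m → Columns m → Rc
  restrictedProfile n f xs with length xs ≤? n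
  ... | yes _ = f (realise n xs)
  ... | no _  = 0#

  restrictedProfile-resp-↭ : ∀ {n} {f : Poly n m} → Sym f → ∀ {xs ys} → xs ↭ ys →
                             restrictedProfile n f xs ≈ restrictedProfile n f ys
  restrictedProfile-resp-↭ {n} f-sym {xs} {ys} p with length xs ≤? n | length ys ≤? n
  ... | yes lx | yes _  = symmetric-realise-↭ f-sym p lx
  ... | no _   | no _   = ≈-refl
  ... | yes lx | no ly  = contradiction (subst (_≤ n) (↭-length p) lx) ly
  ... | no lx  | yes ly = contradiction (subst (_≤ n) (sym (↭-length p)) ly) lx

  π̃-surjective : ∀ a n (f : Poly n m) → InvHom a f → ∃ λ F → InLim a F × (∀ E → F n E ≈ f E)
  π̃-surjective a n f (f-hom , f-sym) = F , ((λ k → F-hom k , F-sym k) , F-π) , F-at-n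
    where
    F : Seq m
    F k E = restrictedProfile n f (nonzeroColumns E)
    F-hom : ∀ k → Homog a (F k)
    F-hom k E mdeg≢a with length (nonzeroColumns E) ≤? n
    ... | yes le = f-hom (realise n (nonzeroColumns E))
                     (mdeg≢a ∘ trans (trans (mdeg-colsum E) (sym (mdeg-realise le))))
    ... | no _   = ≈-refl
    F-sym : ∀ k → Sym (F k)
    F-sym k σ E = restrictedProfile-resp-↭ f-sym (nonzeroColumns-permExpo σ E)
    F-π : ∀ k E → π (F (suc k)) E ≈ F k E
    F-π k E = ≈-reflexive (cong (restrictedProfile n f) (nonzeroColumns-extendExpo E))
    F-at-n : ∀ E → F n E ≈ f E
    F-at-n E with length (nonzeroColumns E) ≤? n
    ... | yes _ = ≈-sym (symmetric-realise f-sym E)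
    ... | no ≰n = contradiction (length-nonzeroColumns≤width E) ≰n

  π̃-injective : ∀ a n → Vec.sum a ≤ n → ∀ F G → InLim a F → InLim a G →
                (∀ E → F n E ≈ G n E) → F ≈∞ G
  π̃-injective a n Σa≤n F G (F-inv , F-π) (G-inv , G-π) Fn≈Gn k E with mdeg E ≟v a
  ... | no mdeg≢a  = ≈-trans (proj₁ (F-inv k) E mdeg≢a) (≈-sym (proj₁ (G-inv k) E mdeg≢a))
  ... | yes mdeg≡a = begin
    F k E               ≈⟨ F.F≈profile E ⟩
    profile F xs        ≈⟨ F.profile-at length≤n ⟨
    F n (realise n xs)  ≈⟨ Fn≈Gn (realise n xs) ⟩
    G n (realise n xs)  ≈⟨ G.profile-at length≤n ⟩
    profile G xs        ≈⟨ G.F≈profile E ⟨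
    G k E               ∎
    where
    module F = Profile (proj₂ ∘ F-inv) F-π
    module G = Profile (proj₂ ∘ G-inv) G-π
    xs : Columns m
    xs = nonzeroColumns E
    length≤n : length xs ≤′ n
    length≤n = ℕ.≤⇒≤′ (ℕ.≤-trans (length-nonzeroColumns≤degree E)
                                  (subst (λ b → Vec.sum b ≤ n) (sym mdeg≡a) Σa≤n))

  e-spans : ∀ a F → InLim a F → ∃ λ L → All (λ p → ∂ (proj₂ p) ≡ a) L × F ≈∞ combo L
  e-spans a F F∈ =
    let L , L-deg , F≈L = e-spans-restricted F∈ {Q = λ _ → ⊤} (λ _ → yes tt) (λ _ _ → tt)
                                             (λ _ _ _ ¬⊤ → contradiction tt ¬⊤)
    in L , All.map proj₁ L-deg , F≈L

  e-independent : ∀ L → Distinct L → (∀ n E → combo L n E ≈ 0#) → All (λ p → proj₁ p ≈ 0#) L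
  e-independent L L-distinct L≈0 =
    lincomb-independent L L-distinct (vanishes-on-nonzero (lincomb L) L≈0)

  e-spans-sum : ∀ D → InSum D → ∃ λ L → ∀ a → D a ≈∞ comboAt L a
  e-spans-sum D (D∈ , S , D-supported) =
    let L , _ , agrees = interpolation Φ Φ-resp-↭ (λ xs → colsum xs ∈? S)
                                       (λ p → subst (_∈ S) (sym (colsum-↭ p))) αs covers vanishes
    in L , D≈L L agrees
    where
    module D b = Profile (proj₂ ∘ proj₁ (D∈ b)) (proj₂ (D∈ b))
    Φ : Columns m → Rc
    Φ xs = profile (D (colsum xs)) xs
    Φ-resp-↭ : ∀ {xs ys} → xs ↭ ys → Φ xs ≈ Φ ys
    Φ-resp-↭ {xs} {ys} p =
      ≈-trans (D.profile-resp-↭ (colsum xs) p) (≈-reflexive (cong (λ b → profile (D b) ys) (colsum-↭ p)))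
    αs : List (Alpha m)
    αs = List.concatMap (candidates ∘ Vec.sum) S
    covers : ∀ xs → AllNonzero xs → colsum xs ∈ S → ∃ λ α → α ∈ αs × monos α ≡ xs
    covers xs xs≢0 deg∈S = let α , α∈ , monos-α≡xs = ∈-candidates xs≢0 in
      α , ∈-concatMap⁺ (candidates ∘ Vec.sum)
            (Any.map (λ deg≡b → subst (λ b → α ∈ candidates (Vec.sum b)) deg≡b α∈) deg∈S) ,
      monos-α≡xs
    vanishes : ∀ xs → AllNonzero xs → ¬ colsum xs ∈ S → Φ xs ≈ 0#
    vanishes xs _ deg∉S = D-supported (colsum xs) deg∉S (length xs) (realise (length xs) xs)
    D≈L : ∀ L → (∀ xs → AllNonzero xs → Φ xs ≈ lincomb L xs) → ∀ a → D a ≈∞ comboAt L a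
    D≈L L agrees a k E with colsum (nonzeroColumns E) ≟v a
    ... | yes deg = begin
      D a k E                           ≈⟨ D.F≈profile a E ⟩
      profile (D a) (nonzeroColumns E)  ≡⟨ cong (λ b → profile (D b) (nonzeroColumns E)) deg ⟨
      Φ (nonzeroColumns E)              ≈⟨ agrees (nonzeroColumns E) (nonzeroColumns-nonzero E) ⟩
      lincomb L (nonzeroColumns E)      ≈⟨ lincombAt-degree L a (nonzeroColumns E) deg ⟨
      lincombAt L a (nonzeroColumns E)  ∎
    ... | no deg≢a = ≈-trans (proj₁ (proj₁ (D∈ a) k) E (deg≢a ∘ trans (sym (mdeg-colsum E))))
                             (≈-sym (lincombAt-off-degree L a (nonzeroColumns E) deg≢a))

  e-independent-sum : ∀ L → Distinct L → (∀ a n E → comboAt L a n E ≈ 0#) → All (λ p → proj₁ p ≈ 0#) L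
  e-independent-sum L L-distinct L≈0 = lincomb-independent L L-distinct λ xs xs≢0 →
    ≈-trans (≈-sym (lincombAt-degree L (colsum xs) xs refl))
            (vanishes-on-nonzero (lincombAt L (colsum xs)) (L≈0 (colsum xs)) xs xs≢0)

proposition3p1 : ∀ {c ℓ : Level} (R : CommutativeRing c ℓ) (m : ℕ) → 2 ≤ m → (a : Vec ℕ m) →
    let open WithRing R in
      (∀ (n : ℕ) → 1 ≤ n → Claim1 m a n × Claim2 m a n) × Claim3 m a × Claim4 m
proposition3p1 R m _ a =
  (λ n _ → ker-π̃ R a n , π̃-surjective R a n , π̃-injective R a n) ,
  (e-spans R a , λ L _ → e-independent R L) ,
  (e-spans-sum R , e-independent-sum R)
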